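{- Let $m\ge1$ and let $v=v_1*v_2$ be a non-empty $m$-Dyck path with $v_1,v_2$ non-empty and $v_2$ prime. If $v\triangleleft w$ is an ordinary $m$-Tamari cover relation, then either $w=w_1*v_2$ where $v_1\triangleleft w_1$, or $w=v_1*w_2$ where $v_2\triangleleft w_2$. Conversely, every ordinary cover relation $v_1\triangleleft w_1$ gives an ordinary cover relation $v_1*v_2\triangleleft w_1*v_2$, and every ordinary cover relation $v_2\triangleleft w_2$ gives an ordinary cover relation $v_1*v_2\triangleleft v_1*w_2$. Consequently, for such $v=v_1*v_2$ with $v_2$ prime, the upper ideal $\{w:v\le w\}$ in the ordinary $m$-Tamari order is $\{w_1*w_2: v_1\le w_1\text{ and }v_2\le w_2\}$.
   Context: An $m$-Dyck path of size $n$ is a word with $n$ letters $1$ (up steps $(+m,+m)$) and $mn$ letters $0$ (down steps $(+1,-1)$) whose lattice path from $(0,0)$ never goes strictly below the horizontal axis. A valley is an occurrence of $01$; a Dyck factor is a factor (consecutive letters) which is itself an $m$-Dyck path. The ordinary $m$-Tamari order is generated by the cover relations $w\triangleleft w'$, one per valley of $w$, where $w'$ is obtained by swapping the down step of the valley with the shortest non-empty Dyck factor immediately following it. A contact is a vertex of height $0$ other than the endpoints; a non-empty path is prime if it has no contact. For non-empty $w_1,w_2$, $w_1*w_2$ is obtained from $w_1$ by replacing its rightmost peak (last occurrence of $10^m$) by $w_2$. -}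

module Defs where

open import Data.Nat using (ℕ; zero; suc; _+_; _*_; _≤_)
open import Data.List using (List; []; _∷_; _++_; replicate; length; filter)
open import Data.Product using (Σ; ∃; ∃-syntax; _×_; _,_)
open import Data.Sum using (_⊎_)
open import Relation.Nullary using (¬_)
open import Relation.Binary.PropositionalEquality using (_≡_; _≢_)
open import Relation.Binary.Construct.Closure.ReflexiveTransitive using (Star)

-- Letters: U is the letter 1 (up step (+m,+m)), D is the letter 0 (down step (+1,-1)).
data Letter : Set where
  U D : Letter

Word : Set
Word = List Letter

data IsDyckFrom (m : ℕ) : ℕ → Word → Set where
  done : IsDyckFrom m 0 []
  up   : ∀ {h w} → IsDyckFrom m (h + m) w → IsDyckFrom m h (U ∷ w)
  down : ∀ {h w} → IsDyckFrom m h w → IsDyckFrom m (suc h) (D ∷ w)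

IsDyck : ℕ → Word → Set
IsDyck m w = IsDyckFrom m 0 w

ups : Word → ℕ
ups []      = 0
ups (U ∷ w) = suc (ups w)
ups (D ∷ w) = ups w

downs : Word → ℕ
downs []      = 0
downs (U ∷ w) = downs w
downs (D ∷ w) = suc (downs w)

-- A contact: a vertex of height 0 other than the endpoints, i.e. a split w = a ++ b
-- with a, b non-empty and the height m·#U(a) − #D(a) of the endpoint of a equal to 0.
HasContact : ℕ → Word → Set
HasContact m w = ∃[ a ] ∃[ b ] (w ≡ a ++ b × a ≢ [] × b ≢ [] × m * ups a ≡ downs a)

Prime : ℕ → Word → Set
Prime m w = w ≢ [] × ¬ HasContact m w

peak : ℕ → Word
peak m = U ∷ replicate m D

-- IsStar m w₁ w₂ w : w = w₁ * w₂, i.e. w is obtained from w₁ by replacing its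
-- rightmost (last) occurrence of 1 0^m by w₂.
IsStar : ℕ → Word → Word → Word → Set
IsStar m w₁ w₂ w =
  ∃[ x ] ∃[ y ]
    ( w₁ ≡ x ++ peak m ++ y
    × (∀ x' y' → w₁ ≡ x' ++ peak m ++ y' → length x' ≤ length x)
    × w ≡ x ++ w₂ ++ y )

ShortestDyck : ℕ → Word → Set
ShortestDyck m f =
  f ≢ [] × IsDyck m f ×
  (∀ p q → f ≡ p ++ q → p ≢ [] → q ≢ [] → ¬ IsDyck m p)

data Cover (m : ℕ) (w w' : Word) : Set where
  cover : IsDyck m w →
          (x f y : Word) →
          ShortestDyck m (U ∷ f) →
          w ≡ x ++ D ∷ (U ∷ f) ++ y →
          w' ≡ x ++ (U ∷ f) ++ D ∷ y →
          Cover m w w'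

TamariLe : ℕ → Word → Word → Set
TamariLe m = Star (Cover m)

-- Write v₁ = x 1 0^m 0^k with 1 0^m its last peak; in a Dyck path everything after the last up step
-- is a run of down steps, so v = x v₂ 0^k. A prime path is an arch: it touches the axis only at its
-- ends. A cover of v swaps the 0 of a valley with the shortest Dyck factor F following it. Comparing
-- heights, F cannot leave v₂ if it starts inside v₂, and cannot end strictly inside v₂ if it starts
-- before it. Hence either the swap takes place inside v₂, where it is a cover of v₂, or it takes place
-- in x with F possibly containing all of v₂; in that case the same swap is a cover for any arch in
-- place of v₂, in particular for the peak 1 0^m, which itself admits no cover.

module Submission where

open import Defs
open import Data.Nat using (ℕ; zero; suc; _+_; _*_; _≤_; _<_; z≤n; s≤s)
open import Data.Nat.Properties
  using (+-suc; +-assoc; +-comm; *-suc; *-zeroʳ; +-identityʳ; m<m+n; <⇒≱)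
open import Data.List using ([]; _∷_; _++_; [_]; replicate; length; initLast; _∷ʳ′_)
open import Data.List.Properties
  using ( ++-assoc; ++-identityʳ; ++-cancelˡ; ++-conicalʳ; ++-monoid
        ; ∷-injective; ∷-injectiveʳ; ∷ʳ-injective; length-++)
open import Data.Product using (∃-syntax; ∃₂; _×_; _,_)
open import Data.Sum using (_⊎_; inj₁; inj₂)
open import Data.Empty using (⊥-elim)
open import Function.Base using (case_of_)
open import Function.Bundles using (_⇔_; mk⇔)
open import Relation.Nullary using (¬_)
open import Relation.Binary.PropositionalEquality
  using (_≡_; _≢_; refl; sym; trans; cong; subst; subst₂; module ≡-Reasoning)
open import Relation.Binary.Construct.Closure.ReflexiveTransitive using (ε; _◅_; _◅◅_)
open import Algebra.Solver.Monoid (++-monoid Letter) using (solve; _⊜_; _⊕_)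

private
  variable
    m h g e e′ n k : ℕ
    a b w w′ w₁ w₂ x y F Q Q′ : Word

-- Heights live in ℕ, so a Path never goes below the axis; IsDyckFrom m h w is Path m h w 0.
data Path (m : ℕ) : ℕ → Word → ℕ → Set where
  stop : Path m h [] h
  rise : Path m (h + m) w e → Path m h (U ∷ w) e
  fall : Path m h w e → Path m (suc h) (D ∷ w) e

dyck⇒path : IsDyckFrom m h w → Path m h w 0
dyck⇒path done     = stop
dyck⇒path (up p)   = rise (dyck⇒path p)
dyck⇒path (down p) = fall (dyck⇒path p)

path⇒dyck : Path m h w 0 → IsDyckFrom m h w
path⇒dyck stop     = done
path⇒dyck (rise p) = up (path⇒dyck p)
path⇒dyck (fall p) = down (path⇒dyck p)

_++ₚ_ : Path m h a g → Path m g b e → Path m h (a ++ b) e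
stop   ++ₚ q = q
rise p ++ₚ q = rise (p ++ₚ q)
fall p ++ₚ q = fall (p ++ₚ q)

split : ∀ a → Path m h (a ++ b) e → ∃[ g ] (Path m h a g × Path m g b e)
split []      p        = _ , stop , p
split (U ∷ a) (rise p) with split a p
... | g , p₁ , p₂ = g , rise p₁ , p₂
split (D ∷ a) (fall p) with split a p
... | g , p₁ , p₂ = g , fall p₁ , p₂

path-end-unique : Path m h w e → Path m h w e′ → e ≡ e′
path-end-unique stop     stop     = refl
path-end-unique (rise p) (rise q) = path-end-unique p q
path-end-unique (fall p) (fall q) = path-end-unique p q

raise : ∀ c → Path m h w e → Path m (c + h) w (c + e)
raise c stop = stop
raise {m} {h} c (rise {w = w} {e = e} p) =
  rise (subst (λ z → Path m z w (c + e)) (sym (+-assoc c h m)) (raise c p))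
raise {m} c (fall {h = h} {w = w} {e = e} p) =
  subst (λ z → Path m z (D ∷ w) (c + e)) (sym (+-suc c h)) (fall (raise c p))

dyck-from : ∀ h → Path m 0 w 0 → Path m h w h
dyck-from {m} {w} h p = subst₂ (λ s t → Path m s w t) (+-identityʳ h) (+-identityʳ h) (raise h p)

path-end-raise : Path m h w e → Path m 0 w e′ → e ≡ h + e′
path-end-raise {m} {h} {w} {e′ = e′} p q =
  path-end-unique p (subst (λ s → Path m s w (h + e′)) (+-identityʳ h) (raise h q))

rising⇒¬returning : Path m 0 w (suc n) → ¬ Path m h w 0
rising⇒¬returning q p with trans (path-end-raise p q) (+-suc _ _)
... | ()

dyck-prefix : Path m 0 (a ++ F) 0 → Path m 0 F 0 → Path m 0 a 0
dyck-prefix {a = a} p dF with split a p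
... | g , p₁ , p₂ with path-end-unique p₂ (dyck-from g dF)
... | refl = p₁

balance : Path m h w e → h + m * ups w ≡ e + downs w
balance {m} {h} stop = cong (h +_) (*-zeroʳ m)
balance {m} {h} (rise {w = w} {e = e} p) = begin
  h + m * suc (ups w) ≡⟨ cong (h +_) (*-suc m (ups w)) ⟩
  h + (m + m * ups w) ≡⟨ sym (+-assoc h m _) ⟩
  h + m + m * ups w   ≡⟨ balance p ⟩
  e + downs w         ∎
  where open ≡-Reasoning
balance (fall {w = w} {e = e} p) = trans (cong suc (balance p)) (sym (+-suc e (downs w)))

path-swap : ∀ x F y → Path m 0 F 0 → Path m h (x ++ D ∷ F ++ y) e → Path m h (x ++ F ++ D ∷ y) e
path-swap x F y dF p with split x p
... | _ , p₁ , fall {h = g} p₂ with split F p₂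
... | _ , p₃ , p₄ with path-end-unique p₃ (dyck-from g dF)
... | refl = p₁ ++ₚ (dyck-from (suc g) dF ++ₚ fall p₄)

path-replace : ∀ x Q Q′ y → Path m 0 Q 0 → Path m 0 Q′ 0 →
  Path m h (x ++ Q ++ y) e → Path m h (x ++ Q′ ++ y) e
path-replace x Q Q′ y dQ dQ′ p with split x p
... | g , p₁ , p₂ with split Q p₂
... | _ , p₃ , p₄ with path-end-unique p₃ (dyck-from g dQ)
... | refl = p₁ ++ₚ (dyck-from g dQ′ ++ₚ p₄)

first-return-view : ∀ c w → Path m (suc c) w 0 →
  (∃₂ λ p s → w ≡ p ++ s × s ≢ [] × Path m (suc c) p 0) ⊎ (∃[ r ] (w ≡ r ++ [ D ] × Path m c r 0))
first-return-view {m} c (U ∷ w) (rise p) with first-return-view (c + m) w p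
... | inj₁ (p′ , s , refl , s≢[] , q) = inj₁ (U ∷ p′ , s , refl , s≢[] , rise q)
... | inj₂ (r , refl , q)             = inj₂ (U ∷ r , refl , rise q)
first-return-view zero    (D ∷ [])    (fall stop) = inj₂ ([] , refl , stop)
first-return-view zero    (D ∷ z ∷ w) (fall _)    = inj₁ ([ D ] , z ∷ w , refl , (λ ()) , fall stop)
first-return-view (suc c) (D ∷ w)     (fall p) with first-return-view c w p
... | inj₁ (p′ , s , refl , s≢[] , q) = inj₁ (D ∷ p′ , s , refl , s≢[] , fall q)
... | inj₂ (r , refl , q)             = inj₂ (D ∷ r , refl , fall q)

++-overlap : ∀ (a b c d : Word) → a ++ b ≡ c ++ d →
  (∃[ t ] (c ≡ a ++ t × b ≡ t ++ d)) ⊎ (∃₂ λ z t → a ≡ c ++ z ∷ t × d ≡ z ∷ t ++ b)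
++-overlap []      b c       d eq = inj₁ (c , refl , eq)
++-overlap (z ∷ a) b []      d eq = inj₂ (z , a , refl , sym eq)
++-overlap (z ∷ a) b (_ ∷ c) d eq with ∷-injective eq
... | refl , eq′ with ++-overlap a b c d eq′
... | inj₁ (t , e₁ , e₂)     = inj₁ (t , cong (z ∷_) e₁ , e₂)
... | inj₂ (z′ , t , e₁ , e₂) = inj₂ (z′ , t , cong (z ∷_) e₁ , e₂)

++-regroup : ∀ (x y z t : Word) → x ++ y ++ z ++ t ≡ (x ++ y ++ z) ++ t
++-regroup x y z t = solve 4 (λ x y z t → x ⊕ (y ⊕ (z ⊕ t)) ⊜ (x ⊕ (y ⊕ z)) ⊕ t) refl x y z t

length-<-++-∷ : ∀ x {c : Letter} {z} → length x < length (x ++ c ∷ z)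
length-<-++-∷ x {c} {z} = subst (length x <_) (sym (length-++ x)) (m<m+n (length x) (s≤s z≤n))

D^ : ℕ → Word
D^ n = replicate n D

D^-path : ∀ n → Path m n (D^ n) 0
D^-path zero    = stop
D^-path (suc n) = fall (D^-path n)

D^-path-start : ∀ n → Path m e (D^ n) 0 → e ≡ n
D^-path-start zero    stop     = refl
D^-path-start (suc n) (fall p) = cong suc (D^-path-start n p)

D^-+ : ∀ i j → D^ i ++ D^ j ≡ D^ (i + j)
D^-+ zero    j = refl
D^-+ (suc i) j = cong (D ∷_) (D^-+ i j)

D^-∷ʳ : ∀ n → D^ n ++ [ D ] ≡ D^ (suc n)
D^-∷ʳ n = trans (D^-+ n 1) (cong D^ (+-comm n 1))

U∉D^ : ∀ n a {b} → D^ n ≢ a ++ U ∷ b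
U∉D^ zero    []      ()
U∉D^ zero    (_ ∷ _) ()
U∉D^ (suc n) []      ()
U∉D^ (suc n) (_ ∷ a) eq = U∉D^ n a (∷-injectiveʳ eq)

D^-insert : ∀ s y → D^ k ≡ s ++ y → s ++ D ∷ y ≡ D^ (suc k)
D^-insert             []      y eq = cong (D ∷_) (sym eq)
D^-insert {k = zero}  (_ ∷ s) y ()
D^-insert {k = suc k} (_ ∷ s) y eq with ∷-injective eq
... | refl , eq′ = cong (D ∷_) (D^-insert s y eq′)

D^-head : ∀ k {z w} → D^ k ≡ z ∷ w → z ≡ D
D^-head (suc k) refl = refl

peak-++-D^ : ∀ m k → peak m ++ D^ k ≡ U ∷ D^ (m + k)
peak-++-D^ m k = cong (U ∷_) (D^-+ m k)

U-position-≤ : ∀ x x′ j z → x ++ U ∷ D^ j ≡ x′ ++ U ∷ z → length x′ ≤ length x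
U-position-≤ []      []       j z eq = z≤n
U-position-≤ []      (_ ∷ x′) j z eq = ⊥-elim (U∉D^ j x′ (∷-injectiveʳ eq))
U-position-≤ (_ ∷ x) []       j z eq = z≤n
U-position-≤ (_ ∷ x) (_ ∷ x′) j z eq = s≤s (U-position-≤ x x′ j z (∷-injectiveʳ eq))

last-U-unique : ∀ x x′ j z → x ++ U ∷ D^ j ≡ x′ ++ U ∷ z → length x ≤ length x′ →
  x ≡ x′ × z ≡ D^ j
last-U-unique []      []       j z eq _         = refl , sym (∷-injectiveʳ eq)
last-U-unique []      (_ ∷ x′) j z eq _         = ⊥-elim (U∉D^ j x′ (∷-injectiveʳ eq))
last-U-unique (_ ∷ x) (_ ∷ x′) j z eq (s≤s le) with ∷-injective eq
... | refl , eq′ with last-U-unique x x′ j z eq′ le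
... | refl , z≡ = refl , z≡

last-U-view : ∀ w → (∃[ k ] (w ≡ D^ k)) ⊎ (∃₂ λ a j → w ≡ a ++ U ∷ D^ j)
last-U-view [] = inj₁ (0 , refl)
last-U-view (U ∷ w) with last-U-view w
... | inj₁ (k , refl)     = inj₂ ([] , k , refl)
... | inj₂ (a , j , refl) = inj₂ (U ∷ a , j , refl)
last-U-view (D ∷ w) with last-U-view w
... | inj₁ (k , refl)     = inj₁ (suc k , refl)
... | inj₂ (a , j , refl) = inj₂ (D ∷ a , j , refl)

final-U-is-peak : ∀ b j → Path m 0 (b ++ U ∷ D^ j) 0 → ∃[ g ] (U ∷ D^ j ≡ peak m ++ D^ g)
final-U-is-peak {m} b j p with split b p
... | g , _ , rise q =
  g , sym (trans (peak-++-D^ m g) (cong (λ i → U ∷ D^ i) (trans (+-comm m g) (D^-path-start j q))))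

isStar-intro : ∀ x k → IsStar m (x ++ peak m ++ D^ k) Q (x ++ Q ++ D^ k)
isStar-intro {m} x k =
  x , D^ k , refl ,
  (λ x′ y′ eq → U-position-≤ x x′ (m + k) _ (trans (cong (x ++_) (sym (peak-++-D^ m k))) eq)) ,
  refl

isStar-result : ∀ x k → IsStar m (x ++ peak m ++ D^ k) Q w → w ≡ x ++ Q ++ D^ k
isStar-result {m} x k (x′ , y′ , eq , maximal , refl)
  with last-U-unique x x′ (m + k) _ (trans (cong (x ++_) (sym (peak-++-D^ m k))) eq) (maximal x (D^ k) refl)
... | refl , eq′ = cong (λ t → x ++ _ ++ t) (++-cancelˡ (D^ m) y′ (D^ k) (trans eq′ (sym (D^-+ m k))))

dyck-star-form : IsDyck m w → IsStar m w Q w′ →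
  ∃₂ λ x k → w ≡ x ++ peak m ++ D^ k × w′ ≡ x ++ Q ++ D^ k
dyck-star-form {m} dw (x , y , refl , maximal , refl) with last-U-view y
... | inj₁ (k , refl) = x , k , refl , refl
... | inj₂ (a , j , refl) =
  let before  = x ++ peak m ++ a
      regroup = ++-regroup x (peak m) a (U ∷ D^ j)
      g , eq  = final-U-is-peak before j (subst (λ t → Path m 0 t 0) regroup (dyck⇒path dw))
  in ⊥-elim (<⇒≱ (length-<-++-∷ x) (maximal before (D^ g) (trans regroup (cong (before ++_) eq))))

peak-¬cover : ¬ Cover m (peak m) w
peak-¬cover (cover _ [] _ _ _ () _)
peak-¬cover {m} (cover _ (_ ∷ x) _ _ _ eq _) =
  U∉D^ m (x ++ [ D ]) (trans (∷-injectiveʳ eq) (sym (++-assoc x [ D ] _)))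

cover-in-context : ∀ x y → IsDyck m (x ++ Q ++ y) → Cover m Q Q′ → Cover m (x ++ Q ++ y) (x ++ Q′ ++ y)
cover-in-context x y dw (cover _ x₀ f y₀ sd refl refl) =
  cover dw (x ++ x₀) f (y₀ ++ y) sd
    (regroup (D ∷ U ∷ f) y₀) (regroup (U ∷ f) (D ∷ y₀))
  where
  regroup : ∀ F z → x ++ (x₀ ++ F ++ z) ++ y ≡ (x ++ x₀) ++ F ++ z ++ y
  regroup F z =
    solve 5 (λ x x₀ F z y → x ⊕ ((x₀ ⊕ (F ⊕ z)) ⊕ y) ⊜ (x ⊕ x₀) ⊕ (F ⊕ (z ⊕ y))) refl x x₀ F z y

cover-target-dyck : Cover m w w′ → IsDyck m w′
cover-target-dyck (cover dw x f y (_ , dF , _) refl refl) =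
  path⇒dyck (path-swap x (U ∷ f) y (dyck⇒path dF) (dyck⇒path dw))

tamari-dyck : TamariLe m w w′ → IsDyck m w → IsDyck m w′
tamari-dyck ε         dw = dw
tamari-dyck (c ◅ w≤w′) _ = tamari-dyck w≤w′ (cover-target-dyck c)

tamari-in-context : ∀ x y → IsDyck m (x ++ Q ++ y) → TamariLe m Q Q′ →
  TamariLe m (x ++ Q ++ y) (x ++ Q′ ++ y)
tamari-in-context x y dw ε         = ε
tamari-in-context x y dw (c ◅ Q≤Q′) =
  cover-in-context x y dw c ◅ tamari-in-context x y (cover-target-dyck (cover-in-context x y dw c)) Q≤Q′

valley-in-dyck-factor : ∀ t {f y₀} → Path m 0 Q 0 → Path m 0 (U ∷ f) 0 →
  Q ++ D^ k ≡ t ++ D ∷ (U ∷ f) ++ y₀ →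
  ∃[ s ] (Q ≡ t ++ D ∷ (U ∷ f) ++ s × y₀ ≡ s ++ D^ k)
valley-in-dyck-factor {m} {Q = Q} {k = k} t {f} {y₀} dQ dF eq with ++-overlap Q (D^ k) t (D ∷ (U ∷ f) ++ y₀) eq
... | inj₁ (t₁ , refl , eq′) = ⊥-elim (U∉D^ k (t₁ ++ [ D ]) (trans eq′ (sym (++-assoc t₁ [ D ] _))))
... | inj₂ (_ , t₂ , refl , eq′) with ∷-injective eq′
... | refl , eq″ with ++-overlap (U ∷ f) y₀ t₂ (D^ k) eq″
... | inj₁ (s , refl , refl) = s , refl , refl
... | inj₂ (_ , s , eF , eq‴) with D^-head k eq‴ | split t dQ | split t₂ (subst (λ w → Path m 0 w 0) eF dF)
... | refl | _ , _ , fall returning | _ , rising , fall _ = ⊥-elim (rising⇒¬returning rising returning)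

module _ {m′ : ℕ} where

  private
    M : ℕ
    M = suc m′

  -- Arch Q: Q = U r D where r, read one level lower, stays ≥ 0, so Q touches the axis only at its ends.
  Arch : Word → Set
  Arch Q = ∃[ r ] (Q ≡ U ∷ r ++ [ D ] × Path M m′ r 0)

  arch⇒path : Arch Q → Path M 0 Q 0
  arch⇒path (r , refl , p) = rise (raise 1 p ++ₚ fall stop)

  arch-nonempty : Arch Q → Q ≢ []
  arch-nonempty (r , refl , p) ()

  peak-arch : Arch (peak M)
  peak-arch = D^ m′ , cong (U ∷_) (sym (D^-∷ʳ m′)) , D^-path m′

  arch-¬contact : Arch (a ++ b) → a ≢ [] → b ≢ [] → ¬ Path M 0 a 0
  arch-¬contact {a = []} _ a≢[] _ _ = a≢[] refl
  arch-¬contact {a = U ∷ a} {b = b} (r , eq , p) _ b≢[] (rise q)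
    with ++-overlap a b r [ D ] (∷-injectiveʳ eq)
  ... | inj₂ (_ , t , _ , eq′) = b≢[] (++-conicalʳ t b (sym (∷-injectiveʳ eq′)))
  ... | inj₁ (t , refl , _) with split a p
  ... | g , p₁ , _ with path-end-unique q (raise 1 p₁)
  ... | ()

  arch-split : Arch (a ++ F ++ b) → a ≢ [] → b ≢ [] →
    ∃₂ λ a′ b′ → (∀ X → a ++ X ++ b ≡ U ∷ (a′ ++ X ++ b′) ++ [ D ]) × Path M m′ (a′ ++ F ++ b′) 0
  arch-split {a = []} _ a≢[] _ = ⊥-elim (a≢[] refl)
  arch-split {a = _ ∷ a′} {F} {b} (r , eq , p) _ b≢[] with initLast b | ∷-injective eq
  ... | []        | _          = ⊥-elim (b≢[] refl)
  ... | b′ ∷ʳ′ d | refl , eq′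
    with ∷ʳ-injective (a′ ++ F ++ b′) r (trans (sym (++-regroup a′ F b′ [ d ])) eq′)
  ... | refl , refl = a′ , b′ , (λ X → cong (U ∷_) (++-regroup a′ X b′ [ D ])) , p

  contact-free⇒arch : Path M 0 Q 0 → Q ≢ [] →
    (∀ p s → Q ≡ p ++ s → p ≢ [] → s ≢ [] → ¬ Path M 0 p 0) → Arch Q
  contact-free⇒arch {Q = []} _ Q≢[] _ = ⊥-elim (Q≢[] refl)
  contact-free⇒arch {Q = U ∷ f} (rise p) _ no-contact with first-return-view m′ f p
  ... | inj₁ (p′ , s , refl , s≢[] , q) = ⊥-elim (no-contact (U ∷ p′) s refl (λ ()) s≢[] (rise q))
  ... | inj₂ (r , refl , q)             = r , refl , q

  arch⇒shortest : Arch Q → ShortestDyck M Q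
  arch⇒shortest A =
    arch-nonempty A , path⇒dyck (arch⇒path A) ,
    λ p s eq p≢[] s≢[] dp → arch-¬contact (subst Arch eq A) p≢[] s≢[] (dyck⇒path dp)

  shortest⇒arch : ShortestDyck M Q → Arch Q
  shortest⇒arch (Q≢[] , dQ , shortest) =
    contact-free⇒arch (dyck⇒path dQ) Q≢[] λ p s eq p≢[] s≢[] dp →
      shortest p s eq p≢[] s≢[] (path⇒dyck dp)

  prime⇒arch : IsDyck M Q → Prime M Q → Arch Q
  prime⇒arch dQ (Q≢[] , no-contact) =
    contact-free⇒arch (dyck⇒path dQ) Q≢[] λ p s eq p≢[] s≢[] dp →
      no-contact (p , s , eq , p≢[] , s≢[] , balance dp)

  arch-¬dyck-suffix : Arch (a ++ F) → a ≢ [] → F ≢ [] → ¬ Path M 0 F 0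
  arch-¬dyck-suffix A a≢[] F≢[] dF = arch-¬contact A a≢[] F≢[] (dyck-prefix (arch⇒path A) dF)

  arch-replace : ∀ a b → Arch Q → Arch Q′ → Arch (a ++ Q ++ b) → Arch (a ++ Q′ ++ b)
  arch-replace {Q′ = Q′} [] [] _ A′ _ = subst Arch (sym (++-identityʳ Q′)) A′
  arch-replace [] (_ ∷ _) AQ _ A = ⊥-elim (arch-¬contact A (arch-nonempty AQ) (λ ()) (arch⇒path AQ))
  arch-replace {Q = Q} a@(_ ∷ _) [] AQ _ A =
    ⊥-elim (arch-¬dyck-suffix {a = a} A (λ ()) (arch-nonempty AQ⁺) (arch⇒path AQ⁺))
    where AQ⁺ = subst Arch (sym (++-identityʳ Q)) AQ
  arch-replace {Q = Q} {Q′} a@(_ ∷ _) b@(_ ∷ _) AQ A′ A with arch-split {a = a} {b = b} A (λ ()) (λ ())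
  ... | a′ , b′ , context , p =
    a′ ++ Q′ ++ b′ , context Q′ , path-replace a′ Q Q′ b′ (arch⇒path AQ) (arch⇒path A′) p

  arch-cover : Arch Q → Cover M Q w → Arch w
  arch-cover (_ , () , _) (cover _ [] _ _ _ refl refl)
  arch-cover A (cover _ x@(_ ∷ _) f [] (_ , dF , _) refl refl) =
    ⊥-elim (arch-¬dyck-suffix {a = x ++ [ D ]} (subst Arch (sym (++-assoc x [ D ] _)) A) (λ ()) (λ ())
             (dyck⇒path (subst (IsDyck _) (sym (++-identityʳ (U ∷ f))) dF)))
  arch-cover A (cover _ x@(_ ∷ _) f y@(_ ∷ _) (_ , dF , _) refl refl)
    with arch-split {a = x} {F = D ∷ U ∷ f} {b = y} A (λ ()) (λ ())
  ... | a′ , b′ , context , p =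
    a′ ++ (U ∷ f) ++ D ∷ b′ ,
    trans (cong (x ++_) (sym (++-assoc (U ∷ f) [ D ] y))) (trans (context ((U ∷ f) ++ [ D ]))
      (cong (λ t → U ∷ t ++ [ D ]) (cong (a′ ++_) (++-assoc (U ∷ f) [ D ] b′)))) ,
    path-swap a′ (U ∷ f) b′ (dyck⇒path dF) p

  cover-at : IsDyck M w → Arch F → w ≡ x ++ D ∷ F ++ y → w′ ≡ x ++ F ++ D ∷ y → Cover M w w′
  cover-at {x = x} {y = y} dw A@(r , refl , _) = cover dw x (r ++ [ D ]) y (arch⇒shortest A)

  valley-before-arch : ∀ t {y₀} → Arch Q → Path M 0 F 0 → F ++ y₀ ≡ t ++ Q ++ D^ k →
    (∃[ s ] (t ≡ F ++ s × y₀ ≡ s ++ Q ++ D^ k)) ⊎ (∃[ s ] (F ≡ t ++ Q ++ s × D^ k ≡ s ++ y₀))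
  valley-before-arch {Q = Q} {F = F} {k = k} t {y₀} AQ dF eq with ++-overlap F y₀ t (Q ++ D^ k) eq
  ... | inj₁ (s , e₁ , e₂) = inj₁ (s , e₁ , e₂)
  ... | inj₂ (z , s₀ , eF , e) with ++-overlap Q (D^ k) (z ∷ s₀) y₀ e
  ... | inj₁ (s , e₁ , e₂) = inj₂ (s , trans eF (cong (t ++_) e₁) , e₂)
  ... | inj₂ (_ , _ , eQ , _)
    with split (z ∷ s₀) (subst (λ w → Path M 0 w 0) eQ (arch⇒path AQ))
       | split t (subst (λ w → Path M 0 w 0) eF dF)
  ... | zero , contact , _ | _ = ⊥-elim (arch-¬contact (subst Arch eQ AQ) (λ ()) (λ ()) contact)
  ... | suc _ , rising , _ | _ , _ , returning = ⊥-elim (rising⇒¬returning rising returning)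

  dyck-replace-arch : ∀ x y → Arch Q → Arch Q′ → IsDyck M (x ++ Q ++ y) → IsDyck M (x ++ Q′ ++ y)
  dyck-replace-arch {Q = Q} {Q′} x y AQ AQ′ d =
    path⇒dyck (path-replace x Q Q′ y (arch⇒path AQ) (arch⇒path AQ′) (dyck⇒path d))

  data CoverSite (x Q : Word) (k : ℕ) (w : Word) : Set where
    inside  : Cover M Q Q′ → w ≡ x ++ Q′ ++ D^ k → CoverSite x Q k w
    outside : ∀ x′ k′ → w ≡ x′ ++ Q ++ D^ k′ →
              (∀ {Q′} → Arch Q′ → Cover M (x ++ Q′ ++ D^ k) (x′ ++ Q′ ++ D^ k′)) →
              CoverSite x Q k w

  cover-site : ∀ x → Arch Q → Cover M (x ++ Q ++ D^ k) w → CoverSite x Q k w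
  cover-site {Q = Q} {k = k} x AQ (cover dv x₀ f y₀ sd@(_ , dF , _) ev refl)
    with ++-overlap x (Q ++ D^ k) x₀ (D ∷ (U ∷ f) ++ y₀) ev
  ... | inj₁ (t , refl , e) with valley-in-dyck-factor t (arch⇒path AQ) (dyck⇒path dF) e
  ... | s , refl , refl =
    inside (cover-at (path⇒dyck (arch⇒path AQ)) AF refl refl)
           (solve 6 (λ x t F d s z → (x ⊕ t) ⊕ (F ⊕ (d ⊕ (s ⊕ z))) ⊜ x ⊕ ((t ⊕ (F ⊕ (d ⊕ s))) ⊕ z))
                  refl x t (U ∷ f) [ D ] s (D^ k))
    where AF = shortest⇒arch sd
  cover-site {Q = Q} {k = k} x AQ (cover dv x₀ f y₀ sd@(_ , dF , _) ev refl) | inj₂ (_ , t , refl , e)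
    with ∷-injective e
  ... | refl , e′ with valley-before-arch t AQ (dyck⇒path dF) e′
  ... | inj₁ (s , refl , refl) =
    outside (x₀ ++ (U ∷ f) ++ D ∷ s) k (sym (regroup (U ∷ f) (D ∷ s) Q))
            λ AQ′ → cover-at (dyck-replace-arch x (D^ k) AQ AQ′ dv) (shortest⇒arch sd)
                             (regroup (D ∷ U ∷ f) s _) (regroup (U ∷ f) (D ∷ s) _)
    where
    regroup : ∀ a b X → (x₀ ++ a ++ b) ++ X ++ D^ k ≡ x₀ ++ a ++ b ++ X ++ D^ k
    regroup a b X = solve 4 (λ x a b X → (x ⊕ (a ⊕ b)) ⊕ X ⊜ x ⊕ (a ⊕ (b ⊕ X))) refl x₀ a b (X ++ D^ k)
  ... | inj₂ (s , eF , eD) =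
    outside (x₀ ++ t) (suc k) (trans (cong (λ F → x₀ ++ F ++ D ∷ y₀) eF) (sym (regroup Q)))
            λ {Q′} AQ′ → cover-at (dyck-replace-arch x (D^ k) AQ AQ′ dv)
                                  (arch-replace t s AQ AQ′ (subst Arch eF (shortest⇒arch sd)))
                                  (regroup′ Q′) (regroup Q′)
    where
    regroup : ∀ X → (x₀ ++ t) ++ X ++ D^ (suc k) ≡ x₀ ++ (t ++ X ++ s) ++ D ∷ y₀
    regroup X = trans (cong (λ z → (x₀ ++ t) ++ X ++ z) (sym (D^-insert s y₀ eD)))
      (solve 5 (λ x t X s y → (x ⊕ t) ⊕ (X ⊕ (s ⊕ y)) ⊜ x ⊕ ((t ⊕ (X ⊕ s)) ⊕ y))
             refl x₀ t X s (D ∷ y₀))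
    regroup′ : ∀ X → x ++ X ++ D^ k ≡ x₀ ++ D ∷ (t ++ X ++ s) ++ y₀
    regroup′ X = trans (cong (λ z → x ++ X ++ z) eD)
      (solve 6 (λ x d t X s y → (x ⊕ (d ⊕ t)) ⊕ (X ⊕ (s ⊕ y)) ⊜ x ⊕ (d ⊕ ((t ⊕ (X ⊕ s)) ⊕ y)))
             refl x₀ [ D ] t X s y₀)

  peak-cover-lift : ∀ x → Arch Q → Cover M (x ++ peak M ++ D^ k) w →
    ∃₂ λ x′ k′ → w ≡ x′ ++ peak M ++ D^ k′ × Cover M (x ++ Q ++ D^ k) (x′ ++ Q ++ D^ k′)
  peak-cover-lift x AQ c with cover-site x peak-arch c
  ... | inside c′ _             = ⊥-elim (peak-¬cover c′)
  ... | outside x′ k′ eq lift = x′ , k′ , eq , lift AQ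

  cover-star-split : ∀ x → Arch Q → Cover M (x ++ Q ++ D^ k) w →
      (∃[ w₁ ] (Cover M (x ++ peak M ++ D^ k) w₁ × IsStar M w₁ Q w))
    ⊎ (∃[ w₂ ] (Cover M Q w₂ × IsStar M (x ++ peak M ++ D^ k) w₂ w))
  cover-star-split {k = k} x AQ c with cover-site x AQ c
  ... | inside c′ refl           = inj₂ (_ , c′ , isStar-intro x k)
  ... | outside x′ k′ refl lift = inj₁ (_ , lift peak-arch , isStar-intro x′ k′)

  tamari-split : ∀ x k → Arch Q → TamariLe M (x ++ Q ++ D^ k) w →
    ∃₂ λ w₁ w₂ → TamariLe M (x ++ peak M ++ D^ k) w₁ × TamariLe M Q w₂ × IsStar M w₁ w₂ w
  tamari-split x k AQ ε = _ , _ , ε , ε , isStar-intro x k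
  tamari-split x k AQ (c ◅ v≤w) with cover-site x AQ c
  ... | inside c′ refl with tamari-split x k (arch-cover AQ c′) v≤w
  ...   | w₁ , w₂ , v₁≤w₁ , v₂≤w₂ , star = w₁ , w₂ , v₁≤w₁ , c′ ◅ v₂≤w₂ , star
  tamari-split x k AQ (c ◅ v≤w) | outside x′ k′ refl lift with tamari-split x′ k′ AQ v≤w
  ...   | w₁ , w₂ , v₁≤w₁ , v₂≤w₂ , star = w₁ , w₂ , lift peak-arch ◅ v₁≤w₁ , v₂≤w₂ , star

  tamari-lift-left : ∀ x k → Arch Q → TamariLe M (x ++ peak M ++ D^ k) w₁ →
    IsStar M w₁ Q w → TamariLe M (x ++ Q ++ D^ k) w
  tamari-lift-left x k AQ ε star rewrite isStar-result x k star = ε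
  tamari-lift-left x k AQ (c ◅ w≤w₁) star with peak-cover-lift x AQ c
  ... | x′ , k′ , refl , c′ = c′ ◅ tamari-lift-left x′ k′ AQ w≤w₁ star

  tamari-join : ∀ x k → Arch Q → IsDyck M (x ++ peak M ++ D^ k) → IsDyck M (x ++ Q ++ D^ k) →
    TamariLe M (x ++ peak M ++ D^ k) w₁ → TamariLe M Q w₂ → IsStar M w₁ w₂ w →
    TamariLe M (x ++ Q ++ D^ k) w
  tamari-join x k AQ dv₁ dv v₁≤w₁ Q≤w₂ star with dyck-star-form (tamari-dyck v₁≤w₁ dv₁) star
  ... | x′ , k′ , refl , refl = v≤w₁⋆Q ◅◅ tamari-in-context x′ (D^ k′) (tamari-dyck v≤w₁⋆Q dv) Q≤w₂
    where v≤w₁⋆Q = tamari-lift-left x k AQ v₁≤w₁ (isStar-intro x′ k′)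

proposition5p2 : (m : ℕ) → 1 ≤ m → (v₁ v₂ v : Word) →
    IsDyck m v₁ → IsDyck m v₂ → IsDyck m v → v ≢ [] → v₁ ≢ [] → Prime m v₂ →
    IsStar m v₁ v₂ v →
      ((w : Word) → Cover m v w →
         (∃[ w₁ ] (Cover m v₁ w₁ × IsStar m w₁ v₂ w))
         ⊎ (∃[ w₂ ] (Cover m v₂ w₂ × IsStar m v₁ w₂ w)))
    × ((w₁ : Word) → Cover m v₁ w₁ → ∃[ w ] (IsStar m w₁ v₂ w × Cover m v w))
    × ((w₂ : Word) → Cover m v₂ w₂ → ∃[ w ] (IsStar m v₁ w₂ w × Cover m v w))
    × ((w : Word) → TamariLe m v w ⇔
         (∃[ w₁ ] ∃[ w₂ ] (TamariLe m v₁ w₁ × TamariLe m v₂ w₂ × IsStar m w₁ w₂ w)))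
proposition5p2 (suc m′) (s≤s z≤n) v₁ v₂ v dv₁ dv₂ dv _ _ prime star with dyck-star-form dv₁ star
... | x , k , refl , refl =
  (λ w → cover-star-split x A₂) ,
  (λ w₁ c → case peak-cover-lift x A₂ c of λ where
     (x′ , k′ , refl , c′) → _ , isStar-intro x′ k′ , c′) ,
  (λ w₂ c → _ , isStar-intro x k , cover-in-context x (D^ k) dv c) ,
  λ w → mk⇔ (tamari-split x k A₂)
             (λ (_ , _ , v₁≤w₁ , v₂≤w₂ , star′) → tamari-join x k A₂ dv₁ dv v₁≤w₁ v₂≤w₂ star′)
  where A₂ = prime⇒arch dv₂ prime
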